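{- Let $n$ be an even positive integer and $i$ a positive integer with $2^{i-1}<n\leq 2^i$. Then $C(n)\geq i$.
   Context: Let $\phi$ be Euler's totient function and $g(n)=n-\phi(n)$ for $n\geq 1$ (the move map of the game \textsc{nontotient}); write $g^i$ for the $i$-fold iterate. For $n\geq 1$, $C(n)$ denotes the least $i\geq 0$ with $g^i(n)=1$. -}

module Defs where

open import Data.Nat using (ℕ; zero; suc; _∸_; _<_; _≟_)
open import Data.Nat.GCD using (gcd)
open import Data.List using (List; length; filter)
open import Data.List.Base using (upTo)
open import Data.Product using (_×_)
open import Relation.Binary.PropositionalEquality using (_≡_; _≢_)

φ : ℕ → ℕ
φ n = length (filter (λ k → gcd (suc k) n ≟ 1) (upTo n))

g : ℕ → ℕ
g n = n ∸ φ n

iter : ℕ → ℕ → ℕ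
iter zero    n = n
iter (suc i) n = g (iter i n)

-- "C n ≡ c": c is the least index with g^c(n) = 1
IsC : ℕ → ℕ → Set
IsC n c = (iter c n ≡ 1) × (∀ j → j < c → iter j n ≢ 1)

-- For even N = 2m with m ≥ 2, the involution k ↦ N − k on the residues coprime
-- to N has no fixed point (m itself is not coprime to N), so φ(N) is twice the
-- number of coprime residues in [1, m − 1]; and no even k is coprime to N, so
-- φ(N) ≤ m. Hence g(N) = N − φ(N) is again even and at least m. By induction on
-- k, if n is even and n > 2^k then g^j(n) is even, so g^j(n) ≠ 1, for all j ≤ k.
module Submission where

open import Defs
open import Data.Nat using (ℕ; zero; suc; _+_; _*_; _∸_; _^_; _<_; _≤_; z≤n; s≤s; _≟_)
open import Data.Nat.Properties
open import Data.Nat.Divisibility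
  using (_∣_; divides; ∣-refl; ∣m∣n⇒∣m+n; ∣m+n∣m⇒∣n; ∣1⇒≡1; _∣0; n∣m*n; m∣m*n)
open import Data.Nat.GCD using (gcd; gcd[m,n]∣m; gcd[m,n]∣n; gcd-greatest)
open import Data.List using (length; filter; _++_; [_])
open import Data.List.Base using (upTo)
open import Data.List.Properties using (upTo-∷ʳ; filter-++; length-++)
open import Data.Product using (_,_)
open import Data.Sum using (_⊎_; inj₁; inj₂)
open import Relation.Nullary using (Dec; yes; no; contradiction)
open import Relation.Unary using (Decidable)
open import Relation.Binary.PropositionalEquality
  using (_≡_; _≢_; refl; sym; trans; cong; cong₂; subst; module ≡-Reasoning)

indicator : ∀ {a} {A : Set a} → Dec A → ℕ
indicator (yes _) = 1
indicator (no  _) = 0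

length-filter-singleton : ∀ {a p} {A : Set a} {P : A → Set p} (P? : Decidable P) x →
  length (filter P? [ x ]) ≡ indicator (P? x)
length-filter-singleton P? x with P? x
... | yes _ = refl
... | no  _ = refl

coprimeIndicator : ℕ → ℕ → ℕ
coprimeIndicator n k = indicator (gcd k n ≟ 1)

coprimesUpTo : ℕ → ℕ → ℕ
coprimesUpTo n zero    = 0
coprimesUpTo n (suc a) = coprimesUpTo n a + coprimeIndicator n (suc a)

coprimeIndicator≤1 : ∀ n k → coprimeIndicator n k ≤ 1
coprimeIndicator≤1 n k with gcd k n ≟ 1
... | yes _ = s≤s z≤n
... | no  _ = z≤n

coprimeIndicator-commonDivisor : ∀ {d k n} → 2 ≤ d → d ∣ k → d ∣ n →
  coprimeIndicator n k ≡ 0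
coprimeIndicator-commonDivisor {d} {k} {n} 2≤d d∣k d∣n with gcd k n ≟ 1
... | no  _      = refl
... | yes gcd≡1 with ∣1⇒≡1 (subst (d ∣_) gcd≡1 (gcd-greatest d∣k d∣n))
...   | refl with 2≤d
...     | s≤s ()

gcd≡1-reflect : ∀ {x y n} → x + y ≡ n → gcd x n ≡ 1 → gcd y n ≡ 1
gcd≡1-reflect {x} {y} {n} x+y≡n gcd≡1 =
  ∣1⇒≡1 (subst (_ ∣_) gcd≡1 (gcd-greatest gcd∣x (gcd[m,n]∣n y n)))
  where
  gcd∣y+x : gcd y n ∣ y + x
  gcd∣y+x = subst (gcd y n ∣_) (trans (sym x+y≡n) (+-comm x y)) (gcd[m,n]∣n y n)
  gcd∣x : gcd y n ∣ x
  gcd∣x = ∣m+n∣m⇒∣n gcd∣y+x (gcd[m,n]∣m y n)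

coprimeIndicator-reflect : ∀ {x y n} → x + y ≡ n →
  coprimeIndicator n x ≡ coprimeIndicator n y
coprimeIndicator-reflect {x} {y} {n} x+y≡n with gcd x n ≟ 1 | gcd y n ≟ 1
... | yes _     | yes _ = refl
... | no  _     | no  _ = refl
... | yes gcd≡1 | no  gcd≢1 = contradiction (gcd≡1-reflect {x} {y} x+y≡n gcd≡1) gcd≢1
... | no  gcd≢1 | yes gcd≡1 =
  contradiction (gcd≡1-reflect {y} {x} (trans (+-comm y x) x+y≡n) gcd≡1) gcd≢1

φ≡coprimesUpTo : ∀ n → φ n ≡ coprimesUpTo n n
φ≡coprimesUpTo n = count n
  where
  coprime? : Decidable (λ k → gcd (suc k) n ≡ 1)
  coprime? = λ k → gcd (suc k) n ≟ 1

  count : ∀ a → length (filter coprime? (upTo a)) ≡ coprimesUpTo n a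
  count zero    = refl
  count (suc a) = begin
    length (filter coprime? (upTo (suc a)))
      ≡⟨ cong (λ xs → length (filter coprime? xs)) (sym (upTo-∷ʳ a)) ⟩
    length (filter coprime? (upTo a ++ [ a ]))
      ≡⟨ cong length (filter-++ coprime? (upTo a) [ a ]) ⟩
    length (filter coprime? (upTo a) ++ filter coprime? [ a ])
      ≡⟨ length-++ (filter coprime? (upTo a)) ⟩
    length (filter coprime? (upTo a)) + length (filter coprime? [ a ])
      ≡⟨ cong₂ _+_ (count a) (length-filter-singleton coprime? a) ⟩
    coprimesUpTo n a + coprimeIndicator n (suc a) ∎
    where open ≡-Reasoning

-- The residues j + 1, …, n − 1 are reflected by k ↦ n − k onto 1, …, t.
coprimesUpTo-reflect : ∀ {n} j t → suc (j + t) ≡ n →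
  coprimesUpTo n j + coprimesUpTo n t ≡ coprimesUpTo n (j + t)
coprimesUpTo-reflect zero    t _ = refl
coprimesUpTo-reflect {n} (suc j) t j+t+1≡n = begin
  (C j + coprimeIndicator n (suc j)) + C t  ≡⟨ cong (λ x → (C j + x) + C t) reflected ⟩
  (C j + coprimeIndicator n (suc t)) + C t  ≡⟨ +-assoc (C j) _ (C t) ⟩
  C j + (coprimeIndicator n (suc t) + C t)  ≡⟨ cong (C j +_) (+-comm _ (C t)) ⟩
  C j + C (suc t)                           ≡⟨ coprimesUpTo-reflect j (suc t) j+1+t+1≡n ⟩
  C (j + suc t)                             ≡⟨ cong C (+-suc j t) ⟩
  C (suc (j + t))                           ∎
  where
  open ≡-Reasoning
  C : ℕ → ℕ
  C = coprimesUpTo n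
  j+1+t+1≡n : suc (j + suc t) ≡ n
  j+1+t+1≡n = trans (cong suc (+-suc j t)) j+t+1≡n
  reflected : coprimeIndicator n (suc j) ≡ coprimeIndicator n (suc t)
  reflected = coprimeIndicator-reflect {suc j} {suc t} j+1+t+1≡n

even⊎odd : ∀ k → 2 ∣ k ⊎ 2 ∣ suc k
even⊎odd zero    = inj₁ (2 ∣0)
even⊎odd (suc k) with even⊎odd k
... | inj₁ 2∣k  = inj₂ (∣m∣n⇒∣m+n {m = 2} ∣-refl 2∣k)
... | inj₂ 2∣1+k = inj₁ 2∣1+k

coprimeIndicator-consecutive : ∀ {n} k → 2 ∣ n →
  coprimeIndicator n k + coprimeIndicator n (suc k) ≤ 1
coprimeIndicator-consecutive {n} k 2∣n with even⊎odd k
... | inj₁ 2∣k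
  rewrite coprimeIndicator-commonDivisor (s≤s (s≤s z≤n)) 2∣k 2∣n =
    coprimeIndicator≤1 n (suc k)
... | inj₂ 2∣1+k
  rewrite coprimeIndicator-commonDivisor (s≤s (s≤s z≤n)) 2∣1+k 2∣n
        | +-identityʳ (coprimeIndicator n k) =
    coprimeIndicator≤1 n k

coprimesUpTo-even-≤ : ∀ {n} a → 2 ∣ n → 2 * coprimesUpTo n a ≤ suc a
coprimesUpTo-even-≤ zero 2∣n = z≤n
coprimesUpTo-even-≤ {n} (suc zero) 2∣n = *-monoʳ-≤ 2 (coprimeIndicator≤1 n 1)
coprimesUpTo-even-≤ {n} (suc (suc a)) 2∣n = begin
  2 * ((C a + x) + y)    ≡⟨ cong (2 *_) (+-assoc (C a) x y) ⟩
  2 * (C a + (x + y))    ≡⟨ *-distribˡ-+ 2 (C a) (x + y) ⟩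
  2 * C a + 2 * (x + y)  ≤⟨ +-mono-≤ (coprimesUpTo-even-≤ a 2∣n)
                                    (*-monoʳ-≤ 2 (coprimeIndicator-consecutive (suc a) 2∣n)) ⟩
  suc a + 2              ≡⟨ +-comm (suc a) 2 ⟩
  suc (suc (suc a))      ∎
  where
  open ≤-Reasoning
  C : ℕ → ℕ
  C = coprimesUpTo n
  x y : ℕ
  x = coprimeIndicator n (suc a)
  y = coprimeIndicator n (suc (suc a))

m*2≡m+m : ∀ m → m * 2 ≡ m + m
m*2≡m+m m = trans (*-comm m 2) (cong (m +_) (+-identityʳ m))

φ-double : ∀ p → 1 ≤ p → φ (suc p * 2) ≡ 2 * coprimesUpTo (suc p * 2) p
φ-double p 1≤p = begin
  φ N                                               ≡⟨ φ≡coprimesUpTo N ⟩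
  C N                                               ≡⟨ cong C N≡ ⟩
  C (p + suc p) + coprimeIndicator N (suc (p + suc p))
                                                    ≡⟨ cong (C (p + suc p) +_) N-not-coprime ⟩
  C (p + suc p) + 0                                 ≡⟨ +-identityʳ _ ⟩
  C (p + suc p)                                     ≡⟨ coprimesUpTo-reflect p (suc p) (sym N≡) ⟨
  C p + (C p + coprimeIndicator N (suc p))          ≡⟨ cong (λ x → C p + (C p + x)) half-not-coprime ⟩
  C p + (C p + 0)                                   ∎
  where
  open ≡-Reasoning
  N : ℕ
  N = suc p * 2
  C : ℕ → ℕ
  C = coprimesUpTo N
  N≡ : N ≡ suc (p + suc p)
  N≡ = m*2≡m+m (suc p)
  N-not-coprime : coprimeIndicator N (suc (p + suc p)) ≡ 0
  N-not-coprime = coprimeIndicator-commonDivisor (s≤s (s≤s z≤n)) (subst (N ∣_) N≡ ∣-refl) ∣-refl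
  half-not-coprime : coprimeIndicator N (suc p) ≡ 0
  half-not-coprime = coprimeIndicator-commonDivisor (s≤s 1≤p) ∣-refl (m∣m*n 2)

g-double≡ : ∀ p → 1 ≤ p → g (suc p * 2) ≡ suc p * 2 ∸ 2 * coprimesUpTo (suc p * 2) p
g-double≡ p 1≤p = cong (suc p * 2 ∸_) (φ-double p 1≤p)

g-double-even : ∀ m → 2 ≤ m → 2 ∣ g (m * 2)
g-double-even (suc p) (s≤s 1≤p) = divides (suc p ∸ A) (begin
  g (suc p * 2)          ≡⟨ g-double≡ p 1≤p ⟩
  suc p * 2 ∸ 2 * A      ≡⟨ cong (suc p * 2 ∸_) (*-comm 2 A) ⟩
  suc p * 2 ∸ A * 2      ≡⟨ *-distribʳ-∸ 2 (suc p) A ⟨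
  (suc p ∸ A) * 2        ∎)
  where
  open ≡-Reasoning
  A : ℕ
  A = coprimesUpTo (suc p * 2) p

g-double-≥ : ∀ m → 2 ≤ m → m ≤ g (m * 2)
g-double-≥ (suc p) (s≤s 1≤p) = subst (m ≤_) (sym (g-double≡ p 1≤p))
  (m+n≤o⇒m≤o∸n m (begin
    m + 2 * A  ≤⟨ +-monoʳ-≤ m (coprimesUpTo-even-≤ p (n∣m*n m)) ⟩
    m + m      ≡⟨ m*2≡m+m m ⟨
    m * 2      ∎))
  where
  open ≤-Reasoning
  m A : ℕ
  m = suc p
  A = coprimesUpTo (m * 2) p

iter-suc : ∀ j n → iter (suc j) n ≡ iter j (g n)
iter-suc zero    n = refl
iter-suc (suc j) n = cong g (iter-suc j n)

2^1+k<m*2⇒2^k<m : ∀ k m → 2 ^ suc k < m * 2 → 2 ^ k < m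
2^1+k<m*2⇒2^k<m k m lt = *-cancelʳ-< 2 (2 ^ k) m (subst (_< m * 2) (*-comm 2 (2 ^ k)) lt)

iter-even≢1 : ∀ k n → 2 ∣ n → 2 ^ k < n → ∀ j → j ≤ k → iter j n ≢ 1
iter-even≢1 k       n 2∣n _ zero _ n≡1 with ∣1⇒≡1 (subst (2 ∣_) n≡1 2∣n)
... | ()
iter-even≢1 zero    n _ _ (suc j) ()
iter-even≢1 (suc k) n (divides m refl) 2^1+k<n (suc j) (s≤s j≤k) iter≡1 =
  iter-even≢1 k (g (m * 2)) (g-double-even m 2≤m) 2^k<g[n] j j≤k
    (trans (sym (iter-suc j (m * 2))) iter≡1)
  where
  2^k<m : 2 ^ k < m
  2^k<m = 2^1+k<m*2⇒2^k<m k m 2^1+k<n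
  2≤m : 2 ≤ m
  2≤m = ≤-trans (s≤s (m^n>0 2 k)) 2^k<m
  2^k<g[n] : 2 ^ k < g (m * 2)
  2^k<g[n] = <-≤-trans 2^k<m (g-double-≥ m 2≤m)

mainTheorem18 : (n i : ℕ) → 0 < n → 2 ∣ n → 0 < i →
    2 ^ (i ∸ 1) < n → n ≤ 2 ^ i →
    (c : ℕ) → IsC n c → i ≤ c
mainTheorem18 n zero    _ _   _ _       _ c _ = z≤n
mainTheorem18 n (suc k) _ 2∣n _ 2^k<n _ c (iter-c≡1 , _) =
  ≮⇒≥ (λ c<1+k → iter-even≢1 k n 2∣n 2^k<n c (≤-pred c<1+k) iter-c≡1)
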